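{- Let $k\ge 2$ and let $a$ be an integer with $a\le k-2$ and $a+k-1$ odd, and let $P(x_1,\dots,x_k)=\operatorname{sign}(a x_1+x_2+\cdots+x_k)$ on $\{ -1,1\}^k$. Let $\tau=\lfloor (k-a-1)/2\rfloor$. Then (1) $\hat P_P = 1-\frac{1}{2^{k-2}}\sum_{l=0}^{\tau}\binom{k-1}{l}$; (2) for every odd $t$ with $1\le t\le k-1$, $\hat P_{tC}=\frac{1}{2^{k-2}}\sum_{i=0}^{\tau}\sum_{j=0}^{\tau-i}(-1)^j\binom{k-t-1}{i}\binom{t}{j}$; (3) for every even $t$ with $2\le t\le k-1$, $\hat P_{P+tC}=-\frac{1}{2^{k-2}}\sum_{i=0}^{\tau}\sum_{j=0}^{\tau-i}(-1)^j\binom{k-t-1}{i}\binom{t}{j}$.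
   Context: For $I\subseteq[k]$ the Fourier coefficient is $\hat P_I=\mathbb{E}_{x}[P(x)\prod_{i\in I}x_i]$ with $x$ uniform on $\{ -1,1\}^k$. Index $1$ is called the president and indices $2,\dots,k$ the citizens. By symmetry $\hat P_I$ depends only on whether $1\in I$ and on $|I\setminus\{1\}|$: $\hat P_P=\hat P_{\{1\}}$, $\hat P_{tC}$ denotes $\hat P_I$ for $I$ a set of $t$ citizens, and $\hat P_{P+tC}$ denotes $\hat P_I$ for $I$ consisting of the president and $t$ citizens. -}

module Defs where

open import Data.Bool using (Bool; true; false; if_then_else_)
open import Data.Nat as ℕ using (ℕ; zero; suc)
open import Data.Nat.Combinatorics using (_C_)
open import Data.Integer as ℤ using (ℤ; +_)
open import Data.Rational as ℚ using (ℚ; 0ℚ; 1ℚ; ½)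
open import Data.Vec using (Vec; []; _∷_)
open import Data.List using (List; []; _∷_; map; concatMap; sum)
open import Data.Product using (∃-syntax; _×_)
open import Data.Empty using (⊥)
open import Relation.Binary.PropositionalEquality using (_≡_)

-- A point of {-1,1}^k: true ↦ +1, false ↦ -1.
val : Bool → ℤ
val true  = + 1
val false = ℤ.- (+ 1)

cube : (n : ℕ) → List (Vec Bool n)
cube zero    = [] ∷ []
cube (suc n) = concatMap (λ xs → (true ∷ xs) ∷ (false ∷ xs) ∷ []) (cube n)

sign : ℤ → ℤ
sign (+ zero)  = + 0
sign (+ suc _) = + 1
sign ℤ.-[1+ _ ] = ℤ.- (+ 1)

sumVals : ∀ {n} → Vec Bool n → ℤ
sumVals []       = + 0
sumVals (b ∷ xs) = val b ℤ.+ sumVals xs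

-- a x₁ + x₂ + ⋯ + x_k  (index 1 = head of the vector = president)
linForm : ℤ → ∀ {n} → Vec Bool n → ℤ
linForm a []       = + 0
linForm a (b ∷ xs) = a ℤ.* val b ℤ.+ sumVals xs

P : ℤ → ∀ {n} → Vec Bool n → ℤ
P a x = sign (linForm a x)

-- A subset I ⊆ [n] as a characteristic vector (true = member).
-- χ_I(x) = ∏_{i ∈ I} x_i
χ : ∀ {n} → Vec Bool n → Vec Bool n → ℤ
χ []       []       = + 1
χ (i ∷ I) (b ∷ xs) = (if i then val b else + 1) ℤ.* χ I xs

half^ : ℕ → ℚ
half^ zero    = 1ℚ
half^ (suc n) = ½ ℚ.* half^ n

sumℤ : List ℤ → ℤ
sumℤ []       = + 0
sumℤ (z ∷ zs) = z ℤ.+ sumℤ zs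

fourier : ∀ {n} → (Vec Bool n → ℤ) → Vec Bool n → ℚ
fourier {n} f I = half^ n ℚ.* (sumℤ (map (λ x → f x ℤ.* χ I x) (cube n)) ℚ./ 1)

card : ∀ {n} → Vec Bool n → ℕ
card []           = 0
card (true ∷ I)  = suc (card I)
card (false ∷ I) = card I

-- I consists of exactly t citizens (president = index 1 = head not in I)
IsCitizens : ∀ {n} → ℕ → Vec Bool n → Set
IsCitizens t []       = t ≡ 0
IsCitizens t (p ∷ J) = p ≡ false × card J ≡ t

IsPresCitizens : ∀ {n} → ℕ → Vec Bool n → Set
IsPresCitizens t []       = ⊥
IsPresCitizens t (p ∷ J) = p ≡ true × card J ≡ t

Oddℤ : ℤ → Set
Oddℤ z = ∃[ m ] z ≡ + 1 ℤ.+ + 2 ℤ.* m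

Σ≤ : ℕ → (ℕ → ℚ) → ℚ
Σ≤ zero    f = f 0
Σ≤ (suc n) f = Σ≤ n f ℚ.+ f (suc n)

sgnPow : ℕ → ℚ
sgnPow zero    = 1ℚ
sgnPow (suc j) = ℚ.- sgnPow j

binom : ℕ → ℕ → ℚ
binom n l = (+ (n C l)) ℚ./ 1

-- τ = ⌊(k - a - 1)/2⌋ ; under a ≤ k-2 we have k - a - 1 ≥ 1, so this
-- is the natural number ∣k - a - 1∣ / 2 (floor division).
tau : ℕ → ℤ → ℕ
tau k a = ℤ.∣ + k ℤ.- a ℤ.- + 1 ∣ ℕ./ 2

doubleSum : ℕ → ℕ → ℕ → ℚ
doubleSum k t τ =
  Σ≤ τ (λ i → Σ≤ (τ ℕ.∸ i) (λ j → sgnPow j ℚ.* binom (k ℕ.∸ t ℕ.∸ 1) i ℚ.* binom t j))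

module Submission where

open import Defs
open import Level using (0ℓ)
open import Data.Bool using (Bool; true; false; if_then_else_)
open import Data.Empty using (⊥; ⊥-elim)
open import Data.Maybe using (nothing)
open import Data.Product using (_×_; _,_; ∃-syntax)
open import Data.List using (List; []; _∷_; map; concatMap)
open import Data.Vec using (Vec; []; _∷_)
open import Data.Nat as ℕ using (ℕ; zero; suc; _∸_; s≤s; z≤n)
import Data.Nat.Properties as ℕP
open import Data.Nat.DivMod using (m/n≡1+[m∸n]/n)
open import Data.Nat.Combinatorics using (_C_; nCk+nC[k+1]≡[n+1]C[k+1])
open import Data.Integer as ℤ using (ℤ; +_; -[1+_])
import Data.Integer.Properties as ℤP
open import Data.Integer.Tactic.RingSolver using (solve-∀)
open import Data.Rational as ℚ using (ℚ; 0ℚ; 1ℚ; ½)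
import Data.Rational.Properties as ℚP
open import Data.Rational.Unnormalised as ℚᵘ using (mkℚᵘ; *≡*)
import Data.Rational.Unnormalised.Properties as ℚᵘP
import Tactic.RingSolver as Ring
open import Tactic.RingSolver.Core.AlmostCommutativeRing using (AlmostCommutativeRing; fromCommutativeRing)
open import Relation.Binary.PropositionalEquality
  using (_≡_; _≢_; refl; sym; trans; cong; cong₂; subst; module ≡-Reasoning)

-- Write x = (x₁, y) with y ∈ {-1,1}^n the n = k - 1 citizens and
-- s their sum.  Summing out the president turns the Fourier sum for I = (p, J)
-- into a correlation  corr J g = Σ_y g(s) χ_J(y)  of the citizen part J with a
-- function of s.  Since a + k - 1 is odd, a x₁ + s never vanishes, so
-- sign = 2·[· > 0] - 1 and P is expressed by the threshold  above a s = [s > a].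
-- The reflection y ↦ -y gives corr J (g ∘ -) = (-1)^|J| corr J g; with the
-- orthogonality Σ_y χ_J(y) = 2^n [J = ∅] this reduces all three cases to
-- 2^{-(k-2)} · corr J (above a).  Finally corr J (above c), for c + 1 + 2τ = n,
-- is computed by induction on J: peeling a citizen gives Pascal-type recursions,
-- also satisfied by  R m t τ = Σ_{i ≤ τ} C(m,i) Σ_{j ≤ τ-i} (-1)^j C(t,j)
-- (m, t = citizens outside / inside J).

sumℤ-cong : ∀ {A : Set} (L : List A) {u v : A → ℤ} → (∀ y → u y ≡ v y) →
  sumℤ (map u L) ≡ sumℤ (map v L)
sumℤ-cong []      e = refl
sumℤ-cong (y ∷ L) e = cong₂ ℤ._+_ (e y) (sumℤ-cong L e)

sumℤ-+ : ∀ {A : Set} (L : List A) (u v : A → ℤ) →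
  sumℤ (map (λ y → u y ℤ.+ v y) L) ≡ sumℤ (map u L) ℤ.+ sumℤ (map v L)
sumℤ-+ []      u v = refl
sumℤ-+ (y ∷ L) u v =
  trans (cong (ℤ._+_ (u y ℤ.+ v y)) (sumℤ-+ L u v)) (interchange (u y) (v y) _ _)
  where
  interchange : ∀ a b c d → (a ℤ.+ b) ℤ.+ (c ℤ.+ d) ≡ (a ℤ.+ c) ℤ.+ (b ℤ.+ d)
  interchange = solve-∀

sumℤ-* : ∀ {A : Set} (L : List A) (c : ℤ) (u : A → ℤ) →
  sumℤ (map (λ y → c ℤ.* u y) L) ≡ c ℤ.* sumℤ (map u L)
sumℤ-* []      c u = sym (ℤP.*-zeroʳ c)
sumℤ-* (y ∷ L) c u =
  trans (cong (ℤ._+_ (c ℤ.* u y)) (sumℤ-* L c u)) (sym (ℤP.*-distribˡ-+ c (u y) _))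

sum-cube-suc : ∀ n (h : Vec Bool (suc n) → ℤ) →
  sumℤ (map h (cube (suc n))) ≡ sumℤ (map (λ y → h (true ∷ y) ℤ.+ h (false ∷ y)) (cube n))
sum-cube-suc n h = split (cube n)
  where
  split : (L : List (Vec Bool n)) →
    sumℤ (map h (concatMap (λ y → (true ∷ y) ∷ (false ∷ y) ∷ []) L)) ≡
    sumℤ (map (λ y → h (true ∷ y) ℤ.+ h (false ∷ y)) L)
  split []      = refl
  split (y ∷ L) = trans (sym (ℤP.+-assoc (h (true ∷ y)) (h (false ∷ y)) _))
                        (cong (ℤ._+_ (h (true ∷ y) ℤ.+ h (false ∷ y))) (split L))

-- Correlation of a character with a symmetric function

corr : ∀ {n} → Vec Bool n → (ℤ → ℤ) → ℤ
corr {n} J g = sumℤ (map (λ y → g (sumVals y) ℤ.* χ J y) (cube n))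

corr-cong : ∀ {n} (J : Vec Bool n) (g h : ℤ → ℤ) →
  (∀ (y : Vec Bool n) → g (sumVals y) ≡ h (sumVals y)) → corr J g ≡ corr J h
corr-cong {n} J g h e = sumℤ-cong (cube n) (λ y → cong (ℤ._* χ J y) (e y))

corr-+ : ∀ {n} (J : Vec Bool n) (g h : ℤ → ℤ) →
  corr J (λ s → g s ℤ.+ h s) ≡ corr J g ℤ.+ corr J h
corr-+ {n} J g h = trans
  (sumℤ-cong (cube n) (λ y → ℤP.*-distribʳ-+ (χ J y) (g (sumVals y)) (h (sumVals y))))
  (sumℤ-+ (cube n) _ _)

corr-* : ∀ {n} (J : Vec Bool n) (c : ℤ) (g : ℤ → ℤ) →
  corr J (λ s → c ℤ.* g s) ≡ c ℤ.* corr J g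
corr-* {n} J c g = trans
  (sumℤ-cong (cube n) (λ y → ℤP.*-assoc c (g (sumVals y)) (χ J y)))
  (sumℤ-* (cube n) c _)

corr-[] : (g : ℤ → ℤ) → corr [] g ≡ g (+ 0)
corr-[] g = trans (ℤP.+-identityʳ _) (ℤP.*-identityʳ (g (+ 0)))

corr-in : ∀ {n} (J : Vec Bool n) (g : ℤ → ℤ) →
  corr (true ∷ J) g ≡ corr J (λ s → g (+ 1 ℤ.+ s) ℤ.- g (ℤ.- (+ 1) ℤ.+ s))
corr-in {n} J g = trans (sum-cube-suc n _) (sumℤ-cong (cube n) (λ y →
  difference (g (+ 1 ℤ.+ sumVals y)) (g (ℤ.- (+ 1) ℤ.+ sumVals y)) (χ J y)))
  where
  difference : ∀ u v x → u ℤ.* (+ 1 ℤ.* x) ℤ.+ v ℤ.* (ℤ.- (+ 1) ℤ.* x) ≡ (u ℤ.- v) ℤ.* x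
  difference = solve-∀

corr-out : ∀ {n} (J : Vec Bool n) (g : ℤ → ℤ) →
  corr (false ∷ J) g ≡ corr J (λ s → g (+ 1 ℤ.+ s) ℤ.+ g (ℤ.- (+ 1) ℤ.+ s))
corr-out {n} J g = trans (sum-cube-suc n _) (sumℤ-cong (cube n) (λ y →
  addition (g (+ 1 ℤ.+ sumVals y)) (g (ℤ.- (+ 1) ℤ.+ sumVals y)) (χ J y)))
  where
  addition : ∀ u v x → u ℤ.* (+ 1 ℤ.* x) ℤ.+ v ℤ.* (+ 1 ℤ.* x) ≡ (u ℤ.+ v) ℤ.* x
  addition = solve-∀

sgn : ℕ → ℤ
sgn zero    = + 1
sgn (suc t) = ℤ.- sgn t

sgn-even : ∀ m → sgn (2 ℕ.* m) ≡ + 1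
sgn-even zero    = refl
sgn-even (suc m) = trans (cong sgn (ℕP.*-suc 2 m)) (trans (ℤP.neg-involutive _) (sgn-even m))

-- The reflection y ↦ -y negates the sum and multiplies χ_J by (-1)^|J|.
corr-reflect : ∀ {n} (J : Vec Bool n) (g : ℤ → ℤ) →
  corr J (λ s → g (ℤ.- s)) ≡ sgn (card J) ℤ.* corr J g
corr-reflect []          g = sym (ℤP.*-identityˡ (corr [] g))
corr-reflect (false ∷ J) g = begin
  corr (false ∷ J) (λ s → g (ℤ.- s))    ≡⟨ corr-out J (λ s → g (ℤ.- s)) ⟩
  corr J reflected                      ≡⟨ corr-cong J reflected (λ s → sum-g (ℤ.- s)) (λ y → swap (sumVals y)) ⟩
  corr J (λ s → sum-g (ℤ.- s))          ≡⟨ corr-reflect J sum-g ⟩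
  sgn (card J) ℤ.* corr J sum-g         ≡⟨ cong (sgn (card J) ℤ.*_) (sym (corr-out J g)) ⟩
  sgn (card J) ℤ.* corr (false ∷ J) g   ∎
  where
  open ≡-Reasoning
  sum-g reflected : ℤ → ℤ
  sum-g s = g (+ 1 ℤ.+ s) ℤ.+ g (ℤ.- (+ 1) ℤ.+ s)
  reflected s = g (ℤ.- (+ 1 ℤ.+ s)) ℤ.+ g (ℤ.- (ℤ.- (+ 1) ℤ.+ s))
  swap : ∀ s → reflected s ≡ sum-g (ℤ.- s)
  swap s = trans (cong₂ ℤ._+_ (cong g (ℤP.neg-distrib-+ (+ 1) s)) (cong g (ℤP.neg-distrib-+ (ℤ.- (+ 1)) s)))
                 (ℤP.+-comm (g (ℤ.- (+ 1) ℤ.+ ℤ.- s)) (g (+ 1 ℤ.+ ℤ.- s)))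
corr-reflect (true ∷ J) g = begin
  corr (true ∷ J) (λ s → g (ℤ.- s))     ≡⟨ corr-in J (λ s → g (ℤ.- s)) ⟩
  corr J reflected                      ≡⟨ corr-cong J reflected (λ s → ℤ.- (+ 1) ℤ.* diff-g (ℤ.- s))
                                                     (λ y → swap (sumVals y)) ⟩
  corr J (λ s → ℤ.- (+ 1) ℤ.* diff-g (ℤ.- s))
    ≡⟨ corr-* J (ℤ.- (+ 1)) (λ s → diff-g (ℤ.- s)) ⟩
  ℤ.- (+ 1) ℤ.* corr J (λ s → diff-g (ℤ.- s))
    ≡⟨ cong (ℤ.- (+ 1) ℤ.*_) (corr-reflect J diff-g) ⟩
  ℤ.- (+ 1) ℤ.* (sgn (card J) ℤ.* corr J diff-g)
    ≡⟨ negate (sgn (card J)) _ ⟩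
  ℤ.- sgn (card J) ℤ.* corr J diff-g    ≡⟨ cong (ℤ.- sgn (card J) ℤ.*_) (sym (corr-in J g)) ⟩
  ℤ.- sgn (card J) ℤ.* corr (true ∷ J) g ∎
  where
  open ≡-Reasoning
  diff-g reflected : ℤ → ℤ
  diff-g s = g (+ 1 ℤ.+ s) ℤ.- g (ℤ.- (+ 1) ℤ.+ s)
  reflected s = g (ℤ.- (+ 1 ℤ.+ s)) ℤ.- g (ℤ.- (ℤ.- (+ 1) ℤ.+ s))
  antisym : ∀ u v → v ℤ.- u ≡ ℤ.- (+ 1) ℤ.* (u ℤ.- v)
  antisym = solve-∀
  swap : ∀ s → reflected s ≡ ℤ.- (+ 1) ℤ.* diff-g (ℤ.- s)
  swap s = trans (cong₂ ℤ._-_ (cong g (ℤP.neg-distrib-+ (+ 1) s)) (cong g (ℤP.neg-distrib-+ (ℤ.- (+ 1)) s)))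
                 (antisym (g (+ 1 ℤ.+ ℤ.- s)) _)
  negate : ∀ e x → ℤ.- (+ 1) ℤ.* (e ℤ.* x) ≡ ℤ.- e ℤ.* x
  negate = solve-∀

pow2 : ℕ → ℤ
pow2 zero    = + 1
pow2 (suc n) = + 2 ℤ.* pow2 n

corr-one-∅ : ∀ {n} (J : Vec Bool n) → card J ≡ 0 → corr J (λ _ → + 1) ≡ pow2 n
corr-one-∅ []          _ = refl
corr-one-∅ (false ∷ J) e =
  trans (corr-out J (λ _ → + 1)) (trans (corr-* J (+ 2) (λ _ → + 1)) (cong (+ 2 ℤ.*_) (corr-one-∅ J e)))

corr-one-nonempty : ∀ {n} (J : Vec Bool n) → 1 ℕ.≤ card J → corr J (λ _ → + 1) ≡ + 0
corr-one-nonempty (true ∷ J)  _ = trans (corr-in J (λ _ → + 1)) (corr-* J (+ 0) (λ _ → + 1))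
corr-one-nonempty (false ∷ J) p =
  trans (corr-out J (λ _ → + 1)) (trans (corr-* J (+ 2) (λ _ → + 1)) (cong (+ 2 ℤ.*_) (corr-one-nonempty J p)))

ℚ-ring : AlmostCommutativeRing 0ℓ 0ℓ
ℚ-ring = fromCommutativeRing ℚP.+-*-commutativeRing (λ _ → nothing)

ι : ℤ → ℚ
ι z = z ℚ./ 1

private
  toℚᵘ-ι : ∀ z → ℚ.toℚᵘ (ι z) ℚᵘ.≃ mkℚᵘ z 0
  toℚᵘ-ι z = ℚP.toℚᵘ-fromℚᵘ (mkℚᵘ z 0)

ι-+ : ∀ x y → ι (x ℤ.+ y) ≡ ι x ℚ.+ ι y
ι-+ x y = ℚP.toℚᵘ-injective (begin
  ℚ.toℚᵘ (ι (x ℤ.+ y))               ≈⟨ toℚᵘ-ι (x ℤ.+ y) ⟩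
  mkℚᵘ (x ℤ.+ y) 0                   ≈⟨ *≡* (cross x y) ⟩
  mkℚᵘ x 0 ℚᵘ.+ mkℚᵘ y 0             ≈⟨ ℚᵘP.+-cong (ℚᵘP.≃-sym (toℚᵘ-ι x)) (ℚᵘP.≃-sym (toℚᵘ-ι y)) ⟩
  ℚ.toℚᵘ (ι x) ℚᵘ.+ ℚ.toℚᵘ (ι y)     ≈⟨ ℚᵘP.≃-sym (ℚP.toℚᵘ-homo-+ (ι x) (ι y)) ⟩
  ℚ.toℚᵘ (ι x ℚ.+ ι y)               ∎)
  where
  open ℚᵘP.≃-Reasoning
  cross : ∀ x y → (x ℤ.+ y) ℤ.* + 1 ≡ (x ℤ.* + 1 ℤ.+ y ℤ.* + 1) ℤ.* + 1
  cross = solve-∀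

ι-* : ∀ x y → ι (x ℤ.* y) ≡ ι x ℚ.* ι y
ι-* x y = ℚP.toℚᵘ-injective (begin
  ℚ.toℚᵘ (ι (x ℤ.* y))               ≈⟨ toℚᵘ-ι (x ℤ.* y) ⟩
  mkℚᵘ x 0 ℚᵘ.* mkℚᵘ y 0             ≈⟨ ℚᵘP.*-cong (ℚᵘP.≃-sym (toℚᵘ-ι x)) (ℚᵘP.≃-sym (toℚᵘ-ι y)) ⟩
  ℚ.toℚᵘ (ι x) ℚᵘ.* ℚ.toℚᵘ (ι y)     ≈⟨ ℚᵘP.≃-sym (ℚP.toℚᵘ-homo-* (ι x) (ι y)) ⟩
  ℚ.toℚᵘ (ι x ℚ.* ι y)               ∎)
  where open ℚᵘP.≃-Reasoning

ι-neg : ∀ x → ι (ℤ.- x) ≡ ℚ.- ι x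
ι-neg (+ zero)   = refl
ι-neg (+ suc n)  = refl
ι-neg -[1+ n ]   = sym (involutive _)
  where
  involutive : ∀ x → ℚ.- (ℚ.- x) ≡ x
  involutive = Ring.solve-∀ ℚ-ring

ι-- : ∀ x y → ι (x ℤ.- y) ≡ ι x ℚ.- ι y
ι-- x y = trans (ι-+ x (ℤ.- y)) (cong (ι x ℚ.+_) (ι-neg y))

Σ-cong≤ : ∀ u (f g : ℕ → ℚ) → (∀ i → i ℕ.≤ u → f i ≡ g i) → Σ≤ u f ≡ Σ≤ u g
Σ-cong≤ zero    f g e = e 0 z≤n
Σ-cong≤ (suc u) f g e =
  cong₂ ℚ._+_ (Σ-cong≤ u f g (λ i p → e i (ℕP.m≤n⇒m≤1+n p))) (e (suc u) ℕP.≤-refl)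

Σ-cong : ∀ u (f g : ℕ → ℚ) → (∀ i → f i ≡ g i) → Σ≤ u f ≡ Σ≤ u g
Σ-cong u f g e = Σ-cong≤ u f g (λ i _ → e i)

Σ-+ : ∀ u (f g : ℕ → ℚ) → Σ≤ u (λ i → f i ℚ.+ g i) ≡ Σ≤ u f ℚ.+ Σ≤ u g
Σ-+ zero    f g = refl
Σ-+ (suc u) f g = trans (cong (ℚ._+ (f (suc u) ℚ.+ g (suc u))) (Σ-+ u f g))
                        (interchange (Σ≤ u f) (Σ≤ u g) (f (suc u)) (g (suc u)))
  where
  interchange : ∀ a b c d → (a ℚ.+ b) ℚ.+ (c ℚ.+ d) ≡ (a ℚ.+ c) ℚ.+ (b ℚ.+ d)
  interchange = Ring.solve-∀ ℚ-ring

Σ-* : ∀ u (c : ℚ) (f : ℕ → ℚ) → Σ≤ u (λ i → c ℚ.* f i) ≡ c ℚ.* Σ≤ u f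
Σ-* zero    c f = refl
Σ-* (suc u) c f = trans (cong (ℚ._+ c ℚ.* f (suc u)) (Σ-* u c f)) (sym (ℚP.*-distribˡ-+ c _ _))

Σ-neg : ∀ u (f : ℕ → ℚ) → Σ≤ u (λ i → ℚ.- f i) ≡ ℚ.- Σ≤ u f
Σ-neg zero    f = refl
Σ-neg (suc u) f = trans (cong (ℚ._+ ℚ.- f (suc u)) (Σ-neg u f))
                        (sym (ℚP.neg-distrib-+ (Σ≤ u f) (f (suc u))))

Σ-head : ∀ u (f : ℕ → ℚ) → Σ≤ (suc u) f ≡ f 0 ℚ.+ Σ≤ u (λ i → f (suc i))
Σ-head zero    f = refl
Σ-head (suc u) f = trans (cong (ℚ._+ f (suc (suc u))) (Σ-head u f))
                         (ℚP.+-assoc (f 0) (Σ≤ u (λ i → f (suc i))) (f (suc (suc u))))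

Σ-zero : ∀ u → Σ≤ u (λ _ → 0ℚ) ≡ 0ℚ
Σ-zero zero    = refl
Σ-zero (suc u) = cong (ℚ._+ 0ℚ) (Σ-zero u)

-- The sums R m t τ

binom-pascal : ∀ m i → binom (suc m) (suc i) ≡ binom m i ℚ.+ binom m (suc i)
binom-pascal m i = trans (cong (λ z → ι (+ z)) (sym (nCk+nC[k+1]≡[n+1]C[k+1] m i)))
  (trans (cong ι (ℤP.pos-+ (m C i) (m C suc i))) (ι-+ (+ (m C i)) (+ (m C suc i))))

Σ-pascal : ∀ m (w : ℕ → ℚ) u →
  Σ≤ (suc u) (λ i → binom (suc m) i ℚ.* w i) ≡
  Σ≤ (suc u) (λ i → binom m i ℚ.* w i) ℚ.+ Σ≤ u (λ i → binom m i ℚ.* w (suc i))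
Σ-pascal m w u = begin
  Σ≤ (suc u) (λ i → binom (suc m) i ℚ.* w i)
    ≡⟨ Σ-head u _ ⟩
  b₀ ℚ.+ Σ≤ u (λ i → binom (suc m) (suc i) ℚ.* w (suc i))
    ≡⟨ cong (b₀ ℚ.+_) (Σ-cong u _ _ λ i →
         trans (cong (ℚ._* w (suc i)) (binom-pascal m i)) (split (binom m i) _ _)) ⟩
  b₀ ℚ.+ Σ≤ u (λ i → binom m (suc i) ℚ.* w (suc i) ℚ.+ binom m i ℚ.* w (suc i))
    ≡⟨ cong (b₀ ℚ.+_) (Σ-+ u _ _) ⟩
  b₀ ℚ.+ (Σ≤ u (λ i → binom m (suc i) ℚ.* w (suc i)) ℚ.+ Σ≤ u (λ i → binom m i ℚ.* w (suc i)))
    ≡⟨ sym (ℚP.+-assoc b₀ _ _) ⟩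
  (b₀ ℚ.+ Σ≤ u (λ i → binom m (suc i) ℚ.* w (suc i))) ℚ.+ Σ≤ u (λ i → binom m i ℚ.* w (suc i))
    ≡⟨ cong (ℚ._+ Σ≤ u (λ i → binom m i ℚ.* w (suc i))) (sym (Σ-head u _)) ⟩
  Σ≤ (suc u) (λ i → binom m i ℚ.* w i) ℚ.+ Σ≤ u (λ i → binom m i ℚ.* w (suc i)) ∎
  where
  open ≡-Reasoning
  b₀ : ℚ
  b₀ = binom m 0 ℚ.* w 0
  split : ∀ a b x → (a ℚ.+ b) ℚ.* x ≡ b ℚ.* x ℚ.+ a ℚ.* x
  split = Ring.solve-∀ ℚ-ring

altSum : ℕ → ℕ → ℚ
altSum t u = Σ≤ u (λ j → sgnPow j ℚ.* binom t j)

altSum-0 : ∀ u → altSum 0 u ≡ 1ℚ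
altSum-0 zero    = refl
altSum-0 (suc u) = trans (cong (ℚ._+ sgnPow (suc u) ℚ.* 0ℚ) (altSum-0 u))
                         (cong (1ℚ ℚ.+_) (ℚP.*-zeroʳ (sgnPow (suc u))))

altSum-pascal : ∀ t u → altSum (suc t) (suc u) ≡ altSum t (suc u) ℚ.- altSum t u
altSum-pascal t u = begin
  altSum (suc t) (suc u)
    ≡⟨ Σ-cong (suc u) _ _ (λ j → ℚP.*-comm (sgnPow j) (binom (suc t) j)) ⟩
  Σ≤ (suc u) (λ j → binom (suc t) j ℚ.* sgnPow j)
    ≡⟨ Σ-pascal t sgnPow u ⟩
  Σ≤ (suc u) (λ j → binom t j ℚ.* sgnPow j) ℚ.+ Σ≤ u (λ j → binom t j ℚ.* sgnPow (suc j))
    ≡⟨ cong₂ ℚ._+_ (Σ-cong (suc u) _ _ (λ j → ℚP.*-comm (binom t j) (sgnPow j)))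
                   (trans (Σ-cong u _ _ (λ j → flip (binom t j) (sgnPow j))) (Σ-neg u _)) ⟩
  altSum t (suc u) ℚ.- altSum t u ∎
  where
  open ≡-Reasoning
  flip : ∀ b s → b ℚ.* (ℚ.- s) ≡ ℚ.- (s ℚ.* b)
  flip = Ring.solve-∀ ℚ-ring

-- R m t τ = Σ_{i ≤ τ} C(m,i) · altSum t (τ-i): the signed count of points with
-- i minus signs among m coordinates and j among t others, i + j ≤ τ, sign (-1)^j.
R : ℕ → ℕ → ℕ → ℚ
R m t τ = Σ≤ τ (λ i → binom m i ℚ.* altSum t (τ ∸ i))

doubleSum≡R : ∀ k t τ → doubleSum k t τ ≡ R (k ∸ t ∸ 1) t τ
doubleSum≡R k t τ = Σ-cong τ _ _ (λ i →
  trans (Σ-cong (τ ∸ i) _ _ (λ j → regroup (sgnPow j) (binom (k ∸ t ∸ 1) i) (binom t j)))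
        (Σ-* (τ ∸ i) (binom (k ∸ t ∸ 1) i) _))
  where
  regroup : ∀ s b c → s ℚ.* b ℚ.* c ≡ b ℚ.* (s ℚ.* c)
  regroup = Ring.solve-∀ ℚ-ring

R-no-inside : ∀ m τ → R m 0 τ ≡ Σ≤ τ (λ l → binom m l)
R-no-inside m τ = Σ-cong τ _ _ (λ i →
  trans (cong (binom m i ℚ.*_) (altSum-0 (τ ∸ i))) (ℚP.*-identityʳ _))

R-empty : ∀ τ → R 0 0 τ ≡ 1ℚ
R-empty zero    = refl
R-empty (suc τ) = begin
  R 0 0 (suc τ)
    ≡⟨ Σ-head τ _ ⟩
  1ℚ ℚ.* altSum 0 (suc τ) ℚ.+ Σ≤ τ (λ i → 0ℚ ℚ.* altSum 0 (τ ∸ i))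
    ≡⟨ cong₂ ℚ._+_ (trans (ℚP.*-identityˡ _) (altSum-0 (suc τ)))
                   (trans (Σ-cong τ _ _ (λ i → ℚP.*-zeroˡ (altSum 0 (τ ∸ i)))) (Σ-zero τ)) ⟩
  1ℚ ℚ.+ 0ℚ ∎
  where open ≡-Reasoning

R-out : ∀ m t τ → R (suc m) t (suc τ) ≡ R m t (suc τ) ℚ.+ R m t τ
R-out m t τ = Σ-pascal m (λ i → altSum t (suc τ ∸ i)) τ

R-in : ∀ m t τ → R m (suc t) (suc τ) ≡ R m t (suc τ) ℚ.- R m t τ
R-in m t τ = begin
  Σ≤ τ (λ i → binom m i ℚ.* altSum (suc t) (suc τ ∸ i)) ℚ.+ last (suc t)
    ≡⟨ cong₂ ℚ._+_ (Σ-cong≤ τ _ _ step) last-same ⟩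
  Σ≤ τ (λ i → binom m i ℚ.* altSum t (suc τ ∸ i) ℚ.+ ℚ.- (binom m i ℚ.* altSum t (τ ∸ i))) ℚ.+ last t
    ≡⟨ cong (ℚ._+ last t) (trans (Σ-+ τ _ _) (cong (S ℚ.+_) (Σ-neg τ _))) ⟩
  (S ℚ.+ ℚ.- R m t τ) ℚ.+ last t
    ≡⟨ rearrange S (R m t τ) (last t) ⟩
  R m t (suc τ) ℚ.- R m t τ ∎
  where
  open ≡-Reasoning
  last : ℕ → ℚ
  last t′ = binom m (suc τ) ℚ.* altSum t′ (τ ∸ τ)
  S : ℚ
  S = Σ≤ τ (λ i → binom m i ℚ.* altSum t (suc τ ∸ i))
  -- the last term only involves altSum _ 0 = 1
  last-same : last (suc t) ≡ last t
  last-same = trans (cong (λ u → binom m (suc τ) ℚ.* altSum (suc t) u) (ℕP.n∸n≡0 τ))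
                    (cong (λ u → binom m (suc τ) ℚ.* altSum t u) (sym (ℕP.n∸n≡0 τ)))
  rearrange : ∀ a b c → (a ℚ.+ ℚ.- b) ℚ.+ c ≡ (a ℚ.+ c) ℚ.- b
  rearrange = Ring.solve-∀ ℚ-ring
  distrib : ∀ b x y → b ℚ.* (x ℚ.- y) ≡ b ℚ.* x ℚ.+ ℚ.- (b ℚ.* y)
  distrib = Ring.solve-∀ ℚ-ring
  step : ∀ i → i ℕ.≤ τ → binom m i ℚ.* altSum (suc t) (suc τ ∸ i) ≡
         binom m i ℚ.* altSum t (suc τ ∸ i) ℚ.+ ℚ.- (binom m i ℚ.* altSum t (τ ∸ i))
  step i i≤τ rewrite ℕP.+-∸-assoc 1 i≤τ =
    trans (cong (binom m i ℚ.*_) (altSum-pascal t (τ ∸ i))) (distrib (binom m i) _ _)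

-- Correlation with a threshold

isPos : ℤ → ℤ
isPos (+ zero)  = + 0
isPos (+ suc _) = + 1
isPos -[1+ _ ]  = + 0

above : ℤ → ℤ → ℤ
above c s = isPos (s ℤ.- c)

outside : ∀ {n} → Vec Bool n → ℕ
outside []          = 0
outside (true ∷ J)  = outside J
outside (false ∷ J) = suc (outside J)

outside+card : ∀ {n} (J : Vec Bool n) → outside J ℕ.+ card J ≡ n
outside+card []          = refl
outside+card (true ∷ J)  = trans (ℕP.+-suc (outside J) (card J)) (cong suc (outside+card J))
outside+card (false ∷ J) = cong suc (outside+card J)

outside≡ : ∀ {n} (J : Vec Bool n) → suc n ∸ card J ∸ 1 ≡ outside J
outside≡ {n} J = begin
  suc n ∸ card J ∸ 1                         ≡⟨ cong (λ z → z ∸ card J ∸ 1) (cong suc (sym (outside+card J))) ⟩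
  suc (outside J ℕ.+ card J) ∸ card J ∸ 1    ≡⟨ cong (_∸ 1) (ℕP.+-∸-assoc 1 (ℕP.m≤n+m (card J) (outside J))) ⟩
  (1 ℕ.+ (outside J ℕ.+ card J ∸ card J)) ∸ 1 ≡⟨ cong (λ z → suc z ∸ 1) (ℕP.m+n∸n≡m (outside J) (card J)) ⟩
  outside J ∎
  where open ≡-Reasoning

above-shift-up : ∀ c s → above c (+ 1 ℤ.+ s) ≡ above (c ℤ.- + 1) s
above-shift-up c s = cong isPos (shift c s)
  where
  shift : ∀ c s → (+ 1 ℤ.+ s) ℤ.- c ≡ s ℤ.- (c ℤ.- + 1)
  shift = solve-∀

above-shift-down : ∀ c s → above c (ℤ.- (+ 1) ℤ.+ s) ≡ above (c ℤ.+ + 1) s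
above-shift-down c s = cong isPos (shift c s)
  where
  shift : ∀ c s → (ℤ.- (+ 1) ℤ.+ s) ℤ.- c ≡ s ℤ.- (c ℤ.+ + 1)
  shift = solve-∀

corr-above-out : ∀ {n} (J : Vec Bool n) c →
  corr (false ∷ J) (above c) ≡ corr J (above (c ℤ.- + 1)) ℤ.+ corr J (above (c ℤ.+ + 1))
corr-above-out J c = trans (corr-out J (above c)) (trans
  (corr-cong J (λ s → above c (+ 1 ℤ.+ s) ℤ.+ above c (ℤ.- (+ 1) ℤ.+ s))
     (λ s → above (c ℤ.- + 1) s ℤ.+ above (c ℤ.+ + 1) s)
     (λ y → cong₂ ℤ._+_ (above-shift-up c (sumVals y)) (above-shift-down c (sumVals y))))
  (corr-+ J (above (c ℤ.- + 1)) (above (c ℤ.+ + 1))))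

corr-above-in : ∀ {n} (J : Vec Bool n) c →
  corr (true ∷ J) (above c) ≡ corr J (above (c ℤ.- + 1)) ℤ.- corr J (above (c ℤ.+ + 1))
corr-above-in J c = begin
  corr (true ∷ J) (above c)
    ≡⟨ corr-in J (above c) ⟩
  corr J (λ s → above c (+ 1 ℤ.+ s) ℤ.- above c (ℤ.- (+ 1) ℤ.+ s))
    ≡⟨ corr-cong J (λ s → above c (+ 1 ℤ.+ s) ℤ.- above c (ℤ.- (+ 1) ℤ.+ s))
                   (λ s → lo s ℤ.+ ℤ.- (+ 1) ℤ.* hi s)
         (λ y → trans (cong₂ ℤ._-_ (above-shift-up c (sumVals y)) (above-shift-down c (sumVals y)))
                      (asSum (lo (sumVals y)) (hi (sumVals y)))) ⟩
  corr J (λ s → lo s ℤ.+ ℤ.- (+ 1) ℤ.* hi s)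
    ≡⟨ corr-+ J lo (λ s → ℤ.- (+ 1) ℤ.* hi s) ⟩
  corr J lo ℤ.+ corr J (λ s → ℤ.- (+ 1) ℤ.* hi s)
    ≡⟨ cong (ℤ._+_ (corr J lo)) (corr-* J (ℤ.- (+ 1)) hi) ⟩
  corr J lo ℤ.+ ℤ.- (+ 1) ℤ.* corr J hi
    ≡⟨ sym (asSum (corr J lo) (corr J hi)) ⟩
  corr J lo ℤ.- corr J hi ∎
  where
  open ≡-Reasoning
  lo hi : ℤ → ℤ
  lo = above (c ℤ.- + 1)
  hi = above (c ℤ.+ + 1)
  asSum : ∀ x y → x ℤ.- y ≡ x ℤ.+ ℤ.- (+ 1) ℤ.* y
  asSum = solve-∀

corr-above-vanish : ∀ {n} (J : Vec Bool n) c d → c ≡ + n ℤ.+ + d → corr J (above c) ≡ + 0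
corr-above-vanish [] c d refl = trans (corr-[] (above (+ d))) (nonpositive d)
  where
  nonpositive : ∀ d → isPos (+ 0 ℤ.- + d) ≡ + 0
  nonpositive zero    = refl
  nonpositive (suc d) = refl
corr-above-vanish {suc n} (b ∷ J) c d refl = peel b
  where
  lower : ∀ n d → ((+ 1 ℤ.+ n) ℤ.+ d) ℤ.- + 1 ≡ n ℤ.+ d
  lower = solve-∀
  raise : ∀ n d → ((+ 1 ℤ.+ n) ℤ.+ d) ℤ.+ + 1 ≡ n ℤ.+ (+ 2 ℤ.+ d)
  raise = solve-∀
  vanish-lo : corr J (above (c ℤ.- + 1)) ≡ + 0
  vanish-lo = corr-above-vanish J _ d (lower (+ n) (+ d))
  vanish-hi : corr J (above (c ℤ.+ + 1)) ≡ + 0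
  vanish-hi = corr-above-vanish J _ (2 ℕ.+ d) (raise (+ n) (+ d))
  peel : ∀ b → corr (b ∷ J) (above c) ≡ + 0
  peel false = trans (corr-above-out J c) (cong₂ ℤ._+_ vanish-lo vanish-hi)
  peel true  = trans (corr-above-in J c) (cong₂ ℤ._-_ vanish-lo vanish-hi)

lower-threshold : ∀ {n} c τ → c ℤ.+ + 1 ℤ.+ + 2 ℤ.* + τ ≡ + suc n →
  (c ℤ.- + 1) ℤ.+ + 1 ℤ.+ + 2 ℤ.* + τ ≡ + n
lower-threshold {n} c τ e = trans (shift c (+ τ)) (trans (cong (ℤ._- + 1) e) (drop (+ n)))
  where
  shift : ∀ c T → (c ℤ.- + 1) ℤ.+ + 1 ℤ.+ + 2 ℤ.* T ≡ (c ℤ.+ + 1 ℤ.+ + 2 ℤ.* T) ℤ.- + 1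
  shift = solve-∀
  drop : ∀ N → (+ 1 ℤ.+ N) ℤ.- + 1 ≡ N
  drop = solve-∀

upper-threshold : ∀ {n} c τ → c ℤ.+ + 1 ℤ.+ + 2 ℤ.* + suc τ ≡ + suc n →
  (c ℤ.+ + 1) ℤ.+ + 1 ℤ.+ + 2 ℤ.* + τ ≡ + n
upper-threshold {n} c τ e = trans (shift c (+ τ)) (trans (cong (ℤ._- + 1) e) (drop (+ n)))
  where
  shift : ∀ c T → (c ℤ.+ + 1) ℤ.+ + 1 ℤ.+ + 2 ℤ.* T ≡ (c ℤ.+ + 1 ℤ.+ + 2 ℤ.* (+ 1 ℤ.+ T)) ℤ.- + 1
  shift = solve-∀
  drop : ∀ N → (+ 1 ℤ.+ N) ℤ.- + 1 ≡ N
  drop = solve-∀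

top-threshold : ∀ {n} c → c ℤ.+ + 1 ℤ.+ + 2 ℤ.* + 0 ≡ + suc n → c ℤ.+ + 1 ≡ + n ℤ.+ + 1
top-threshold {n} c e = trans (pad c) (trans e (ℤP.+-comm (+ 1) (+ n)))
  where
  pad : ∀ c → c ℤ.+ + 1 ≡ c ℤ.+ + 1 ℤ.+ + 2 ℤ.* + 0
  pad = solve-∀

-- Main count: if c + 1 + 2τ = n then Σ_y [s(y) > c] χ_J(y) = R (outside J) |J| τ;
-- indeed s(y) > c exactly when y has at most τ minus signs.
corr-above : ∀ {n} (J : Vec Bool n) τ c → c ℤ.+ + 1 ℤ.+ + 2 ℤ.* + τ ≡ + n →
  ι (corr J (above c)) ≡ R (outside J) (card J) τ
corr-above [] τ c e = begin
  ι (corr [] (above c))   ≡⟨ cong ι (corr-[] (above c)) ⟩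
  ι (isPos (+ 0 ℤ.- c))   ≡⟨ cong (λ z → ι (isPos z)) (begin
      + 0 ℤ.- c                                           ≡⟨ shift c (+ τ) ⟩
      (+ 1 ℤ.+ + 2 ℤ.* + τ) ℤ.- (c ℤ.+ + 1 ℤ.+ + 2 ℤ.* + τ) ≡⟨ cong (ℤ._-_ (+ 1 ℤ.+ + 2 ℤ.* + τ)) e ⟩
      (+ 1 ℤ.+ + 2 ℤ.* + τ) ℤ.+ + 0                       ≡⟨ ℤP.+-identityʳ _ ⟩
      + 1 ℤ.+ + 2 ℤ.* + τ                                 ≡⟨ cong (ℤ._+_ (+ 1)) (sym (ℤP.pos-* 2 τ)) ⟩
      + suc (2 ℕ.* τ)                                     ∎) ⟩
  1ℚ                      ≡⟨ sym (R-empty τ) ⟩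
  R 0 0 τ                 ∎
  where
  open ≡-Reasoning
  shift : ∀ c T → + 0 ℤ.- c ≡ (+ 1 ℤ.+ + 2 ℤ.* T) ℤ.- (c ℤ.+ + 1 ℤ.+ + 2 ℤ.* T)
  shift = solve-∀
corr-above {suc n} (false ∷ J) τ c e = begin
  ι (corr (false ∷ J) (above c))  ≡⟨ cong ι (corr-above-out J c) ⟩
  ι (lo ℤ.+ hi)                   ≡⟨ ι-+ lo hi ⟩
  ι lo ℚ.+ ι hi                   ≡⟨ cong (ℚ._+ ι hi) (corr-above J τ _ (lower-threshold c τ e)) ⟩
  R m t τ ℚ.+ ι hi                ≡⟨ add-upper τ e ⟩
  R (suc m) t τ                   ∎
  where
  open ≡-Reasoning
  lo : ℤ
  lo = corr J (above (c ℤ.- + 1))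
  hi : ℤ
  hi = corr J (above (c ℤ.+ + 1))
  m : ℕ
  m = outside J
  t : ℕ
  t = card J
  -- the upper threshold c + 1 has parameter τ - 1; for τ = 0 it is the maximal
  -- sum n, so it contributes nothing
  add-upper : ∀ τ → c ℤ.+ + 1 ℤ.+ + 2 ℤ.* + τ ≡ + suc n → R m t τ ℚ.+ ι hi ≡ R (suc m) t τ
  add-upper zero    e′ = trans (cong (λ z → R m t 0 ℚ.+ ι z) (corr-above-vanish J _ 1 (top-threshold c e′)))
                               (ℚP.+-identityʳ _)
  add-upper (suc τ) e′ = trans (cong (R m t (suc τ) ℚ.+_) (corr-above J τ _ (upper-threshold c τ e′)))
                               (sym (R-out m t τ))
corr-above {suc n} (true ∷ J) τ c e = begin
  ι (corr (true ∷ J) (above c))   ≡⟨ cong ι (corr-above-in J c) ⟩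
  ι (lo ℤ.- hi)                   ≡⟨ ι-- lo hi ⟩
  ι lo ℚ.- ι hi                   ≡⟨ cong (ℚ._- ι hi) (corr-above J τ _ (lower-threshold c τ e)) ⟩
  R m t τ ℚ.- ι hi                ≡⟨ subtract-upper τ e ⟩
  R m (suc t) τ                   ∎
  where
  open ≡-Reasoning
  lo : ℤ
  lo = corr J (above (c ℤ.- + 1))
  hi : ℤ
  hi = corr J (above (c ℤ.+ + 1))
  m : ℕ
  m = outside J
  t : ℕ
  t = card J
  -- as in the previous clause, for τ = 0 the upper threshold contributes nothing
  subtract-upper : ∀ τ → c ℤ.+ + 1 ℤ.+ + 2 ℤ.* + τ ≡ + suc n → R m t τ ℚ.- ι hi ≡ R m (suc t) τ
  subtract-upper zero    e′ = trans (cong (λ z → R m t 0 ℚ.- ι z) (corr-above-vanish J _ 1 (top-threshold c e′)))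
                                    (ℚP.+-identityʳ _)
  subtract-upper (suc τ) e′ = trans (cong (ℚ._-_ (R m t (suc τ))) (corr-above J τ _ (upper-threshold c τ e′)))
                                    (sym (R-in m t τ))

sign-isPos : ∀ z → z ≢ + 0 → sign z ≡ + 2 ℤ.* isPos z ℤ.- + 1
sign-isPos (+ zero)  z≢0 = ⊥-elim (z≢0 refl)
sign-isPos (+ suc _) _   = refl
sign-isPos -[1+ _ ]  _   = refl

isPos-neg : ∀ z → z ≢ + 0 → isPos (ℤ.- z) ≡ + 1 ℤ.- isPos z
isPos-neg (+ zero)  z≢0 = ⊥-elim (z≢0 refl)
isPos-neg (+ suc _) _   = refl
isPos-neg -[1+ _ ]  _   = refl

sign-president-up : ∀ a s → a ℤ.* + 1 ℤ.+ s ≢ + 0 →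
  sign (a ℤ.* + 1 ℤ.+ s) ≡ + 1 ℤ.- + 2 ℤ.* above a (ℤ.- s)
sign-president-up a s nz = begin
  sign u                                   ≡⟨ sign-isPos u nz ⟩
  + 2 ℤ.* isPos u ℤ.- + 1                   ≡⟨ complement (isPos u) ⟩
  + 1 ℤ.- + 2 ℤ.* (+ 1 ℤ.- isPos u)         ≡⟨ cong (λ z → + 1 ℤ.- + 2 ℤ.* z) (sym (isPos-neg u nz)) ⟩
  + 1 ℤ.- + 2 ℤ.* isPos (ℤ.- u)             ≡⟨ cong (λ z → + 1 ℤ.- + 2 ℤ.* isPos z) (negated a s) ⟩
  + 1 ℤ.- + 2 ℤ.* above a (ℤ.- s)           ∎
  where
  open ≡-Reasoning
  u : ℤ
  u = a ℤ.* + 1 ℤ.+ s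
  complement : ∀ x → + 2 ℤ.* x ℤ.- + 1 ≡ + 1 ℤ.- + 2 ℤ.* (+ 1 ℤ.- x)
  complement = solve-∀
  negated : ∀ a s → ℤ.- (a ℤ.* + 1 ℤ.+ s) ≡ ℤ.- s ℤ.- a
  negated = solve-∀

sign-president-down : ∀ a s → a ℤ.* ℤ.- (+ 1) ℤ.+ s ≢ + 0 →
  sign (a ℤ.* ℤ.- (+ 1) ℤ.+ s) ≡ + 2 ℤ.* above a s ℤ.- + 1
sign-president-down a s nz =
  trans (sign-isPos _ nz) (cong (λ z → + 2 ℤ.* isPos z ℤ.- + 1) (flipped a s))
  where
  flipped : ∀ a s → a ℤ.* ℤ.- (+ 1) ℤ.+ s ≡ s ℤ.- a
  flipped = solve-∀

sumVals-parity : ∀ {n} (y : Vec Bool n) → ∃[ w ] sumVals y ≡ + n ℤ.+ + 2 ℤ.* w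
sumVals-parity [] = + 0 , refl
sumVals-parity {suc n} (true ∷ y) with sumVals-parity y
... | w , e = w , trans (cong (ℤ._+_ (+ 1)) e) (step (+ n) w)
  where
  step : ∀ N w → + 1 ℤ.+ (N ℤ.+ + 2 ℤ.* w) ≡ (+ 1 ℤ.+ N) ℤ.+ + 2 ℤ.* w
  step = solve-∀
sumVals-parity {suc n} (false ∷ y) with sumVals-parity y
... | w , e = w ℤ.- + 1 , trans (cong (ℤ._+_ (ℤ.- (+ 1))) e) (step (+ n) w)
  where
  step : ∀ N w → ℤ.- (+ 1) ℤ.+ (N ℤ.+ + 2 ℤ.* w) ≡ (+ 1 ℤ.+ N) ℤ.+ + 2 ℤ.* (w ℤ.- + 1)
  step = solve-∀

odd-+-even : ∀ {z} w → Oddℤ z → Oddℤ (z ℤ.+ + 2 ℤ.* w)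
odd-+-even w (m , refl) = m ℤ.+ w , regroup m w
  where
  regroup : ∀ m w → (+ 1 ℤ.+ + 2 ℤ.* m) ℤ.+ + 2 ℤ.* w ≡ + 1 ℤ.+ + 2 ℤ.* (m ℤ.+ w)
  regroup = solve-∀

odd≢0 : ∀ {z} → Oddℤ z → z ≢ + 0
odd≢0 (m , refl) odd≡0 = twice≢-1 m (trans (halve m) (cong (ℤ._- + 1) odd≡0))
  where
  halve : ∀ m → m ℤ.+ m ≡ (+ 1 ℤ.+ + 2 ℤ.* m) ℤ.- + 1
  halve = solve-∀
  twice≢-1 : ∀ m → m ℤ.+ m ≢ ℤ.- (+ 1)
  twice≢-1 (+ zero)  ()
  twice≢-1 (+ suc _) ()
  twice≢-1 -[1+ _ ]  ()

-- If a + k - 1 is odd then a x₁ + x₂ + ⋯ + x_k is odd on the whole cube;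
-- in particular it never vanishes, so P takes only the values ±1.
linForm-odd : ∀ {n} a → Oddℤ (a ℤ.+ + suc n ℤ.- + 1) → (x : Vec Bool (suc n)) → Oddℤ (linForm a x)
linForm-odd {n} a odd (b ∷ y) with sumVals-parity y
linForm-odd {n} a odd (true ∷ y)  | w , e =
  subst Oddℤ (sym (trans (cong (ℤ._+_ (a ℤ.* + 1)) e) (regroup a (+ n) w))) (odd-+-even w odd)
  where
  regroup : ∀ a N w → a ℤ.* + 1 ℤ.+ (N ℤ.+ + 2 ℤ.* w) ≡ (a ℤ.+ (+ 1 ℤ.+ N) ℤ.- + 1) ℤ.+ + 2 ℤ.* w
  regroup = solve-∀
linForm-odd {n} a odd (false ∷ y) | w , e =
  subst Oddℤ (sym (trans (cong (ℤ._+_ (a ℤ.* ℤ.- (+ 1))) e) (regroup a (+ n) w))) (odd-+-even (w ℤ.- a) odd)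
  where
  regroup : ∀ a N w → a ℤ.* ℤ.- (+ 1) ℤ.+ (N ℤ.+ + 2 ℤ.* w) ≡ (a ℤ.+ (+ 1 ℤ.+ N) ℤ.- + 1) ℤ.+ + 2 ℤ.* (w ℤ.- a)
  regroup = solve-∀

half-odd : ∀ q → suc (2 ℕ.* q) ℕ./ 2 ≡ q
half-odd zero    = refl
half-odd (suc q) = trans (cong (λ z → suc z ℕ./ 2) (ℕP.*-suc 2 q))
  (trans (m/n≡1+[m∸n]/n {suc (2 ℕ.+ 2 ℕ.* q)} {2} (s≤s (s≤s z≤n))) (cong suc (half-odd q)))

-- For a ≤ k - 2 with a + k - 1 odd, k - a - 1 = 2τ + 1 exactly; equivalently the
-- threshold a lies 2τ + 1 below the largest citizens' sum k - 1.
tau-spec : ∀ n a → a ℤ.≤ + n → Oddℤ (a ℤ.+ + suc (suc n) ℤ.- + 1) →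
  a ℤ.+ + 1 ℤ.+ + 2 ℤ.* + tau (suc (suc n)) a ≡ + suc n
tau-spec n a a≤n (m , odd) = from-gap (m ℤ.- a) gap
  where
  open ≡-Reasoning
  unshift : ∀ a N → N ℤ.- a ≡ ((a ℤ.+ (+ 2 ℤ.+ N)) ℤ.- + 1) ℤ.- + 1 ℤ.+ + 2 ℤ.* ℤ.- a
  unshift = solve-∀
  double : ∀ m a → (+ 1 ℤ.+ + 2 ℤ.* m) ℤ.- + 1 ℤ.+ + 2 ℤ.* ℤ.- a ≡ + 2 ℤ.* (m ℤ.- a)
  double = solve-∀
  -- (k - 2) - a = 2(m - a) is even, and nonnegative because a ≤ k - 2
  gap : + n ℤ.- a ≡ + 2 ℤ.* (m ℤ.- a)
  gap = trans (unshift a (+ n)) (trans (cong (λ z → z ℤ.- + 1 ℤ.+ + 2 ℤ.* ℤ.- a) odd) (double m a))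
  from-gap : ∀ w → + n ℤ.- a ≡ + 2 ℤ.* w → a ℤ.+ + 1 ℤ.+ + 2 ℤ.* + tau (suc (suc n)) a ≡ + suc n
  from-gap (+ q) e = begin
    a ℤ.+ + 1 ℤ.+ + 2 ℤ.* + tau (suc (suc n)) a  ≡⟨ cong (λ t → a ℤ.+ + 1 ℤ.+ + 2 ℤ.* + t) tau≡q ⟩
    a ℤ.+ + 1 ℤ.+ + 2 ℤ.* + q                     ≡⟨ cong (ℤ._+_ (a ℤ.+ + 1)) (sym e) ⟩
    a ℤ.+ + 1 ℤ.+ (+ n ℤ.- a)                     ≡⟨ cancel a (+ n) ⟩
    + 1 ℤ.+ + n                                   ∎
    where
    cancel : ∀ a N → a ℤ.+ + 1 ℤ.+ (N ℤ.- a) ≡ + 1 ℤ.+ N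
    cancel = solve-∀
    rearrange : ∀ a N → (+ 2 ℤ.+ N) ℤ.- a ℤ.- + 1 ≡ + 1 ℤ.+ (N ℤ.- a)
    rearrange = solve-∀
    k-a-1 : + suc (suc n) ℤ.- a ℤ.- + 1 ≡ + suc (2 ℕ.* q)
    k-a-1 = trans (rearrange a (+ n)) (trans (cong (ℤ._+_ (+ 1)) e) (cong (ℤ._+_ (+ 1)) (sym (ℤP.pos-* 2 q))))
    tau≡q : tau (suc (suc n)) a ≡ q
    tau≡q = trans (cong (λ z → ℤ.∣ z ∣ ℕ./ 2) k-a-1) (half-odd q)
  from-gap -[1+ r ] e = ⊥-elim (negative (subst (+ 0 ℤ.≤_) e (ℤP.i≤j⇒0≤j-i a≤n)))
    where
    negative : + 0 ℤ.≤ + 2 ℤ.* -[1+ r ] → ⊥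
    negative ()

-- Summing out the president

-- Half the total contribution of x₁ = ±1 to P(x) χ_I(x), as a function of the
-- citizens' sum s; the flag says whether the president belongs to I.
presidentTerm : ℤ → Bool → ℤ → ℤ
presidentTerm a true  s = + 1 ℤ.- above a s ℤ.- above a (ℤ.- s)
presidentTerm a false s = above a s ℤ.- above a (ℤ.- s)

president-pair : ∀ a p s X → a ℤ.* + 1 ℤ.+ s ≢ + 0 → a ℤ.* ℤ.- (+ 1) ℤ.+ s ≢ + 0 →
  sign (a ℤ.* + 1 ℤ.+ s) ℤ.* ((if p then val true else + 1) ℤ.* X) ℤ.+
  sign (a ℤ.* ℤ.- (+ 1) ℤ.+ s) ℤ.* ((if p then val false else + 1) ℤ.* X)
  ≡ (+ 2 ℤ.* presidentTerm a p s) ℤ.* X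
president-pair a true s X nz₊ nz₋ =
  trans (cong₂ (λ u v → u ℤ.* (+ 1 ℤ.* X) ℤ.+ v ℤ.* (ℤ.- (+ 1) ℤ.* X))
               (sign-president-up a s nz₊) (sign-president-down a s nz₋))
        (collect (above a s) (above a (ℤ.- s)) X)
  where
  collect : ∀ A A′ X → (+ 1 ℤ.- + 2 ℤ.* A′) ℤ.* (+ 1 ℤ.* X) ℤ.+ (+ 2 ℤ.* A ℤ.- + 1) ℤ.* (ℤ.- (+ 1) ℤ.* X)
                     ≡ (+ 2 ℤ.* (+ 1 ℤ.- A ℤ.- A′)) ℤ.* X
  collect = solve-∀
president-pair a false s X nz₊ nz₋ =
  trans (cong₂ (λ u v → u ℤ.* (+ 1 ℤ.* X) ℤ.+ v ℤ.* (+ 1 ℤ.* X))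
               (sign-president-up a s nz₊) (sign-president-down a s nz₋))
        (collect (above a s) (above a (ℤ.- s)) X)
  where
  collect : ∀ A A′ X → (+ 1 ℤ.- + 2 ℤ.* A′) ℤ.* (+ 1 ℤ.* X) ℤ.+ (+ 2 ℤ.* A ℤ.- + 1) ℤ.* (+ 1 ℤ.* X)
                     ≡ (+ 2 ℤ.* (A ℤ.- A′)) ℤ.* X
  collect = solve-∀

sum-P-χ : ∀ {n} a p (J : Vec Bool n) → (∀ x → linForm a x ≢ + 0) →
  sumℤ (map (λ x → P a x ℤ.* χ (p ∷ J) x) (cube (suc n))) ≡ + 2 ℤ.* corr J (presidentTerm a p)
sum-P-χ {n} a p J nz = trans (sum-cube-suc n (λ x → P a x ℤ.* χ (p ∷ J) x)) (trans
  (sumℤ-cong (cube n) (λ y → president-pair a p (sumVals y) (χ J y) (nz (true ∷ y)) (nz (false ∷ y))))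
  (corr-* J (+ 2) (presidentTerm a p)))

half-double : ∀ n x → half^ (suc n) ℚ.* ι (+ 2 ℤ.* x) ≡ half^ n ℚ.* ι x
half-double n x = trans (cong (half^ (suc n) ℚ.*_) (ι-* (+ 2) x)) (cancel (half^ n) (ι x))
  where
  cancel : ∀ h y → ½ ℚ.* h ℚ.* (ι (+ 2) ℚ.* y) ≡ h ℚ.* y
  cancel = Ring.solve-∀ ℚ-ring

half^-pow2 : ∀ n → half^ n ℚ.* ι (pow2 n) ≡ 1ℚ
half^-pow2 zero    = refl
half^-pow2 (suc n) = trans (half-double n (pow2 n)) (half^-pow2 n)

fourier-via-corr : ∀ {n} a p (J : Vec Bool n) → (∀ x → linForm a x ≢ + 0) →
  fourier (P a) (p ∷ J) ≡ half^ n ℚ.* ι (corr J (presidentTerm a p))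
fourier-via-corr {n} a p J nz =
  trans (cong (λ z → half^ (suc n) ℚ.* ι z) (sum-P-χ a p J nz)) (half-double n (corr J (presidentTerm a p)))

-- The correlations of presidentTerm, by the reflection symmetry.
corr-presidentTerm-out : ∀ {n} a (J : Vec Bool n) →
  corr J (presidentTerm a false) ≡ (+ 1 ℤ.- sgn (card J)) ℤ.* corr J (above a)
corr-presidentTerm-out a J = begin
  corr J (presidentTerm a false)
    ≡⟨ corr-cong J (presidentTerm a false) (λ s → above a s ℤ.+ ℤ.- (+ 1) ℤ.* above a (ℤ.- s))
                 (λ y → asSum (above a (sumVals y)) (above a (ℤ.- sumVals y))) ⟩
  corr J (λ s → above a s ℤ.+ ℤ.- (+ 1) ℤ.* above a (ℤ.- s))
    ≡⟨ corr-+ J (above a) (λ s → ℤ.- (+ 1) ℤ.* above a (ℤ.- s)) ⟩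
  S ℤ.+ corr J (λ s → ℤ.- (+ 1) ℤ.* above a (ℤ.- s))
    ≡⟨ cong (ℤ._+_ S) (trans (corr-* J (ℤ.- (+ 1)) (λ s → above a (ℤ.- s)))
                             (cong (ℤ.- (+ 1) ℤ.*_) (corr-reflect J (above a)))) ⟩
  S ℤ.+ ℤ.- (+ 1) ℤ.* (sgn (card J) ℤ.* S)
    ≡⟨ collect (sgn (card J)) S ⟩
  (+ 1 ℤ.- sgn (card J)) ℤ.* S ∎
  where
  open ≡-Reasoning
  S : ℤ
  S = corr J (above a)
  asSum : ∀ x y → x ℤ.- y ≡ x ℤ.+ ℤ.- (+ 1) ℤ.* y
  asSum = solve-∀
  collect : ∀ e S → S ℤ.+ ℤ.- (+ 1) ℤ.* (e ℤ.* S) ≡ (+ 1 ℤ.- e) ℤ.* S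
  collect = solve-∀

corr-presidentTerm-in : ∀ {n} a (J : Vec Bool n) →
  corr J (presidentTerm a true) ≡ corr J (λ _ → + 1) ℤ.- (+ 1 ℤ.+ sgn (card J)) ℤ.* corr J (above a)
corr-presidentTerm-in a J = begin
  corr J (presidentTerm a true)
    ≡⟨ corr-cong J (presidentTerm a true) (λ s → + 1 ℤ.+ (m1 ℤ.* above a s ℤ.+ m1 ℤ.* above a (ℤ.- s)))
                 (λ y → asSum (above a (sumVals y)) (above a (ℤ.- sumVals y))) ⟩
  corr J (λ s → + 1 ℤ.+ (m1 ℤ.* above a s ℤ.+ m1 ℤ.* above a (ℤ.- s)))
    ≡⟨ corr-+ J (λ _ → + 1) (λ s → m1 ℤ.* above a s ℤ.+ m1 ℤ.* above a (ℤ.- s)) ⟩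
  One ℤ.+ corr J (λ s → m1 ℤ.* above a s ℤ.+ m1 ℤ.* above a (ℤ.- s))
    ≡⟨ cong (ℤ._+_ One) (corr-+ J (λ s → m1 ℤ.* above a s) (λ s → m1 ℤ.* above a (ℤ.- s))) ⟩
  One ℤ.+ (corr J (λ s → m1 ℤ.* above a s) ℤ.+ corr J (λ s → m1 ℤ.* above a (ℤ.- s)))
    ≡⟨ cong (ℤ._+_ One) (cong₂ ℤ._+_ (corr-* J m1 (above a))
         (trans (corr-* J m1 (λ s → above a (ℤ.- s))) (cong (m1 ℤ.*_) (corr-reflect J (above a))))) ⟩
  One ℤ.+ (m1 ℤ.* S ℤ.+ m1 ℤ.* (sgn (card J) ℤ.* S))
    ≡⟨ collect One (sgn (card J)) S ⟩
  One ℤ.- (+ 1 ℤ.+ sgn (card J)) ℤ.* S ∎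
  where
  open ≡-Reasoning
  m1 : ℤ
  m1 = ℤ.- (+ 1)
  S : ℤ
  S = corr J (above a)
  One : ℤ
  One = corr J (λ _ → + 1)
  asSum : ∀ x y → + 1 ℤ.- x ℤ.- y ≡ + 1 ℤ.+ (ℤ.- (+ 1) ℤ.* x ℤ.+ ℤ.- (+ 1) ℤ.* y)
  asSum = solve-∀
  collect : ∀ O e S → O ℤ.+ (ℤ.- (+ 1) ℤ.* S ℤ.+ ℤ.- (+ 1) ℤ.* (e ℤ.* S)) ≡ O ℤ.- (+ 1 ℤ.+ e) ℤ.* S
  collect = solve-∀

-- The three families of coefficients, in terms of S = corr J (above a)

fourier-president : ∀ {n} a (J : Vec Bool (suc n)) → (∀ x → linForm a x ≢ + 0) → card J ≡ 0 →
  fourier (P a) (true ∷ J) ≡ 1ℚ ℚ.- half^ n ℚ.* ι (corr J (above a))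
fourier-president {n} a J nz J≡∅ = begin
  fourier (P a) (true ∷ J)
    ≡⟨ fourier-via-corr a true J nz ⟩
  half^ (suc n) ℚ.* ι (corr J (presidentTerm a true))
    ≡⟨ cong (λ z → half^ (suc n) ℚ.* ι z) (begin
         corr J (presidentTerm a true)                 ≡⟨ corr-presidentTerm-in a J ⟩
         One ℤ.- (+ 1 ℤ.+ sgn (card J)) ℤ.* S           ≡⟨ cong₂ (λ o t → o ℤ.- (+ 1 ℤ.+ sgn t) ℤ.* S)
                                                                 (corr-one-∅ J J≡∅) J≡∅ ⟩
         + 2 ℤ.* pow2 n ℤ.- + 2 ℤ.* S                  ≡⟨ factor (pow2 n) S ⟩
         + 2 ℤ.* (pow2 n ℤ.- S)                        ∎) ⟩
  half^ (suc n) ℚ.* ι (+ 2 ℤ.* (pow2 n ℤ.- S))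
    ≡⟨ half-double n (pow2 n ℤ.- S) ⟩
  half^ n ℚ.* ι (pow2 n ℤ.- S)
    ≡⟨ cong (half^ n ℚ.*_) (ι-- (pow2 n) S) ⟩
  half^ n ℚ.* (ι (pow2 n) ℚ.- ι S)
    ≡⟨ distrib (half^ n) (ι (pow2 n)) (ι S) ⟩
  half^ n ℚ.* ι (pow2 n) ℚ.- half^ n ℚ.* ι S
    ≡⟨ cong (ℚ._- half^ n ℚ.* ι S) (half^-pow2 n) ⟩
  1ℚ ℚ.- half^ n ℚ.* ι S ∎
  where
  open ≡-Reasoning
  S : ℤ
  S = corr J (above a)
  One : ℤ
  One = corr J (λ _ → + 1)
  factor : ∀ x y → + 2 ℤ.* x ℤ.- + 2 ℤ.* y ≡ + 2 ℤ.* (x ℤ.- y)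
  factor = solve-∀
  distrib : ∀ h x y → h ℚ.* (x ℚ.- y) ≡ h ℚ.* x ℚ.- h ℚ.* y
  distrib = Ring.solve-∀ ℚ-ring

fourier-citizens : ∀ {n} a (J : Vec Bool (suc n)) → (∀ x → linForm a x ≢ + 0) →
  ∃[ m ] card J ≡ 1 ℕ.+ 2 ℕ.* m →
  fourier (P a) (false ∷ J) ≡ half^ n ℚ.* ι (corr J (above a))
fourier-citizens {n} a J nz (m , J-odd) = begin
  fourier (P a) (false ∷ J)
    ≡⟨ fourier-via-corr a false J nz ⟩
  half^ (suc n) ℚ.* ι (corr J (presidentTerm a false))
    ≡⟨ cong (λ z → half^ (suc n) ℚ.* ι z) (trans (corr-presidentTerm-out a J)
         (cong (λ e → (+ 1 ℤ.- e) ℤ.* corr J (above a)) (trans (cong sgn J-odd) (cong ℤ.-_ (sgn-even m))))) ⟩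
  half^ (suc n) ℚ.* ι (+ 2 ℤ.* corr J (above a))
    ≡⟨ half-double n (corr J (above a)) ⟩
  half^ n ℚ.* ι (corr J (above a)) ∎
  where open ≡-Reasoning

fourier-president-citizens : ∀ {n} a (J : Vec Bool (suc n)) → (∀ x → linForm a x ≢ + 0) →
  ∃[ m ] card J ≡ 2 ℕ.* m → 1 ℕ.≤ card J →
  fourier (P a) (true ∷ J) ≡ ℚ.- (half^ n ℚ.* ι (corr J (above a)))
fourier-president-citizens {n} a J nz (m , J-even) J≢∅ = begin
  fourier (P a) (true ∷ J)
    ≡⟨ fourier-via-corr a true J nz ⟩
  half^ (suc n) ℚ.* ι (corr J (presidentTerm a true))
    ≡⟨ cong (λ z → half^ (suc n) ℚ.* ι z) (begin
         corr J (presidentTerm a true)                   ≡⟨ corr-presidentTerm-in a J ⟩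
         One ℤ.- (+ 1 ℤ.+ sgn (card J)) ℤ.* S             ≡⟨ cong₂ (λ o e → o ℤ.- (+ 1 ℤ.+ e) ℤ.* S)
                                                                   (corr-one-nonempty J J≢∅)
                                                                   (trans (cong sgn J-even) (sgn-even m)) ⟩
         + 0 ℤ.- + 2 ℤ.* S                               ≡⟨ factor S ⟩
         + 2 ℤ.* ℤ.- S                                   ∎) ⟩
  half^ (suc n) ℚ.* ι (+ 2 ℤ.* ℤ.- S)
    ≡⟨ half-double n (ℤ.- S) ⟩
  half^ n ℚ.* ι (ℤ.- S)
    ≡⟨ cong (half^ n ℚ.*_) (ι-neg S) ⟩
  half^ n ℚ.* ℚ.- ι S
    ≡⟨ sym (ℚP.neg-distribʳ-* (half^ n) (ι S)) ⟩
  ℚ.- (half^ n ℚ.* ι S) ∎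
  where
  open ≡-Reasoning
  S : ℤ
  S = corr J (above a)
  One : ℤ
  One = corr J (λ _ → + 1)
  factor : ∀ x → + 0 ℤ.- + 2 ℤ.* x ≡ + 2 ℤ.* ℤ.- x
  factor = solve-∀

threshold-count : ∀ n a → a ℤ.≤ + n → Oddℤ (a ℤ.+ + suc (suc n) ℤ.- + 1) → (J : Vec Bool (suc n)) →
  ι (corr J (above a)) ≡ R (suc (suc n) ∸ card J ∸ 1) (card J) (tau (suc (suc n)) a)
threshold-count n a a≤n odd J =
  trans (corr-above J (tau (suc (suc n)) a) a (tau-spec n a a≤n odd))
        (cong (λ m → R m (card J) (tau (suc (suc n)) a)) (sym (outside≡ J)))

lemma2p1 : (k : ℕ) (a : ℤ) → 2 ℕ.≤ k → a ℤ.≤ + (k ∸ 2) → Oddℤ (a ℤ.+ + k ℤ.- + 1) →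
    ((I : Vec Bool k) → IsPresCitizens 0 I →
      fourier (P a) I ≡ 1ℚ ℚ.- half^ (k ∸ 2) ℚ.* Σ≤ (tau k a) (λ l → binom (k ∸ 1) l))
    × ((t : ℕ) → ∃[ m ] t ≡ 1 ℕ.+ 2 ℕ.* m → 1 ℕ.≤ t → t ℕ.≤ k ∸ 1 →
      (I : Vec Bool k) → IsCitizens t I →
      fourier (P a) I ≡ half^ (k ∸ 2) ℚ.* doubleSum k t (tau k a))
    × ((t : ℕ) → ∃[ m ] t ≡ 2 ℕ.* m → 2 ℕ.≤ t → t ℕ.≤ k ∸ 1 →
      (I : Vec Bool k) → IsPresCitizens t I →
      fourier (P a) I ≡ ℚ.- (half^ (k ∸ 2) ℚ.* doubleSum k t (tau k a)))
lemma2p1 (suc (suc n)) a (s≤s (s≤s _)) a≤n odd =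
  (λ { (true ∷ J) (refl , J≡∅) → trans (fourier-president a J nonzero J≡∅)
         (cong (λ z → 1ℚ ℚ.- half^ n ℚ.* z)
               (trans (count J) (trans (cong (λ t → R (k ∸ t ∸ 1) t τ) J≡∅) (R-no-inside (suc n) τ)))) })
  , (λ { .(card J) J-odd _ _ (false ∷ J) (refl , refl) → trans (fourier-citizens a J nonzero J-odd)
         (cong (half^ n ℚ.*_) (trans (count J) (sym (doubleSum≡R k (card J) τ)))) })
  , (λ { .(card J) J-even 2≤|J| _ (true ∷ J) (refl , refl) →
         trans (fourier-president-citizens a J nonzero J-even (ℕP.≤-trans (s≤s z≤n) 2≤|J|))
               (cong (λ z → ℚ.- (half^ n ℚ.* z)) (trans (count J) (sym (doubleSum≡R k (card J) τ)))) })
  where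
  k : ℕ
  k = suc (suc n)
  τ : ℕ
  τ = tau k a
  nonzero : ∀ x → linForm a x ≢ + 0
  nonzero x = odd≢0 (linForm-odd a odd x)
  count : (J : Vec Bool (suc n)) → ι (corr J (above a)) ≡ R (k ∸ card J ∸ 1) (card J) τ
  count = threshold-count n a a≤n odd
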